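{- Let $\varepsilon\in\{ -1,1\}$ and $z\in\mathbb{Z}$ with $z(z+1)\neq 0$. Let $L=(k+3)\sigma^2-\varepsilon(2k+3)(1+2z)\sigma+k\in\mathbb{Q}[k][\sigma]$, and for $s\in\mathbb{N}$ let $x_{s+2}(k)=2(2k+3)^s(k+1)(k+2)$ (so $x_{2s+2}(k)=2(2k+3)^{2s}(k+1)(k+2)$). Put $\eta=\frac{1-\varepsilon(1+2z)}{2}\in\mathbb{Z}$. Then for any $r\in\mathbb{N}$ there exist $u_s\in\mathbb{N}$ and $v_s\in\mathbb{Z}$ ($0\le s\le r-1$) such that, as polynomials in $k$, \[ (2k+1)^{2r+1}=\sum_{s=0}^{r-1}\frac{v_s}{\eta^{u_s}}L^\ast(x_{2s+2}(k))+(2k+1). \]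
   Context: $\mathbb{N}=\{0,1,2,\dots\}$. $\sigma$ is the shift operator, $\sigma F(k)=F(k+1)$. For $L=\sum_{i=0}^{J}a_i(k)\sigma^i$, the adjoint is the map $L^*(x(k))=\sum_{i=0}^{J}a_i(k-i)x(k-i)$ on polynomials $x(k)$; here $a_2(k)=k+3$, $a_1(k)=-\varepsilon(2k+3)(1+2z)$, $a_0(k)=k$. -}

module Defs where

open import Data.Nat using (ℕ; zero; suc)
open import Data.Integer as ℤ using (ℤ)
open import Data.Rational using (ℚ; 0ℚ; 1ℚ; _+_; _*_; _-_; -_; _/_; _÷_; _≟_; ≢-nonZero)
open import Relation.Nullary using (yes; no)

⟦_⟧ : ℤ → ℚ
⟦ n ⟧ = n / 1

_^ℚ_ : ℚ → ℕ → ℚ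
p ^ℚ zero  = 1ℚ
p ^ℚ suc n = p * (p ^ℚ n)

-- division p / q in ℚ; the value for q = 0 is an arbitrary convention (0),
-- never used in the statement since η ≠ 0 there
_⊘_ : ℚ → ℚ → ℚ
p ⊘ q with q ≟ 0ℚ
... | yes _  = 0ℚ
... | no q≢0 = _÷_ p q {{≢-nonZero q≢0}}

sumTo : ℕ → (ℕ → ℚ) → ℚ
sumTo zero    f = 0ℚ
sumTo (suc r) f = sumTo r f + f r

two three : ℚ
two   = 1ℚ + 1ℚ
three = two + 1ℚ

-- coefficients of L = a₂(k)σ² + a₁(k)σ + a₀(k), parameters ε z ∈ ℤ
a₂ a₁ a₀ : ℤ → ℤ → ℚ → ℚ
a₂ ε z k = k + three
a₁ ε z k = - (⟦ ε ⟧ * ((two * k + three) * (1ℚ + two * ⟦ z ⟧)))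
a₀ ε z k = k

Ladj : ℤ → ℤ → (ℚ → ℚ) → ℚ → ℚ
Ladj ε z x k = a₀ ε z k * x k
             + a₁ ε z (k - 1ℚ) * x (k - 1ℚ)
             + a₂ ε z (k - two) * x (k - two)

x[_+2] : ℕ → ℚ → ℚ
x[ s +2] k = two * ((two * k + three) ^ℚ s) * (k + 1ℚ) * (k + two)

η : ℤ → ℤ → ℚ
η ε z = (1ℚ - ⟦ ε ⟧ * (1ℚ + two * ⟦ z ⟧)) ⊘ two

module Submission where

-- Put t = 2k + 1 and T = t². Writing ((t ± 2)²)ˢ = Tˢ + 4 (μ(T) ± t ν(T)) with integer
-- polynomials μ, ν of degree < s, the adjoint becomes L*(x_{2s+2}) = (T − 1) t (η Tˢ + β_s(T))
-- with β_s an integer polynomial of degree < s. This family is triangular with diagonal η, so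
-- η^r (1 + T + ⋯ + T^{r−1}) is an integer combination of L*(x_2), …, L*(x_{2r}); multiplying
-- by (T − 1) t turns the geometric sum into t^{2r+1} − t.

open import Defs
open import Level using (0ℓ)
open import Data.Nat using (ℕ; zero; suc; _<_)
import Data.Nat as ℕ
import Data.Nat.Properties as ℕₚ
open import Data.Integer using (ℤ; +_; -[1+_]; 0ℤ)
import Data.Integer as ℤ
import Data.Integer.Properties as ℤₚ
open import Data.Integer.GCD using (gcd)
import Data.Integer.Tactic.RingSolver as ℤ-Solver
open import Data.Rational using (ℚ; 0ℚ; 1ℚ; _+_; _*_; _-_; -_; _/_; 1/_; _≟_; NonZero; toℚᵘ; ≢-nonZero)
open import Data.Rational.Properties
  using (+-*-commutativeRing; toℚᵘ-injective; toℚᵘ-fromℚᵘ; toℚᵘ-homo-+; toℚᵘ-homo-*; toℚᵘ-homo‿-;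
         p≡0⇒↥p≡0; ↥-/; *-inverseˡ; *-assoc; *-zeroʳ; *-identityˡ; *-distribˡ-+; *-distribʳ-+)
import Data.Rational.Unnormalised as ℚᵘ
import Data.Rational.Unnormalised.Properties as ℚᵘₚ
open import Data.Product using (Σ; _×_; _,_; proj₁; proj₂)
open import Data.Sum using (_⊎_; inj₁; inj₂)
open import Data.Empty using (⊥-elim)
open import Relation.Nullary using (yes; no)
open import Relation.Nullary.Decidable using (dec⇒maybe)
open import Relation.Binary.PropositionalEquality
open import Tactic.RingSolver using (solve-∀)
open import Tactic.RingSolver.Core.AlmostCommutativeRing using (AlmostCommutativeRing; fromCommutativeRing)

ℚring : AlmostCommutativeRing 0ℓ 0ℓ
ℚring = fromCommutativeRing +-*-commutativeRing (λ x → dec⇒maybe (0ℚ ≟ x))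

toℚᵘ-⟦⟧ : ∀ i → toℚᵘ ⟦ i ⟧ ℚᵘ.≃ ℚᵘ.mkℚᵘ i 0
toℚᵘ-⟦⟧ i = toℚᵘ-fromℚᵘ (ℚᵘ.mkℚᵘ i 0)

⟦⟧-+ : ∀ i j → ⟦ i ℤ.+ j ⟧ ≡ ⟦ i ⟧ + ⟦ j ⟧
⟦⟧-+ i j = toℚᵘ-injective (begin
  toℚᵘ ⟦ i ℤ.+ j ⟧                       ≈⟨ toℚᵘ-⟦⟧ (i ℤ.+ j) ⟩
  ℚᵘ.mkℚᵘ (i ℤ.+ j) 0                    ≈⟨ ℚᵘ.*≡* (denominators-one i j) ⟩
  ℚᵘ.mkℚᵘ i 0 ℚᵘ.+ ℚᵘ.mkℚᵘ j 0           ≈⟨ ℚᵘₚ.+-cong (toℚᵘ-⟦⟧ i) (toℚᵘ-⟦⟧ j) ⟨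
  toℚᵘ ⟦ i ⟧ ℚᵘ.+ toℚᵘ ⟦ j ⟧              ≈⟨ toℚᵘ-homo-+ ⟦ i ⟧ ⟦ j ⟧ ⟨
  toℚᵘ (⟦ i ⟧ + ⟦ j ⟧)                   ∎)
  where
  open ℚᵘₚ.≃-Reasoning
  denominators-one : ∀ i j → (i ℤ.+ j) ℤ.* + 1 ≡ (i ℤ.* + 1 ℤ.+ j ℤ.* + 1) ℤ.* + 1
  denominators-one = ℤ-Solver.solve-∀

⟦⟧-* : ∀ i j → ⟦ i ℤ.* j ⟧ ≡ ⟦ i ⟧ * ⟦ j ⟧
⟦⟧-* i j = toℚᵘ-injective (begin
  toℚᵘ ⟦ i ℤ.* j ⟧                       ≈⟨ toℚᵘ-⟦⟧ (i ℤ.* j) ⟩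
  ℚᵘ.mkℚᵘ i 0 ℚᵘ.* ℚᵘ.mkℚᵘ j 0           ≈⟨ ℚᵘₚ.*-cong (toℚᵘ-⟦⟧ i) (toℚᵘ-⟦⟧ j) ⟨
  toℚᵘ ⟦ i ⟧ ℚᵘ.* toℚᵘ ⟦ j ⟧              ≈⟨ toℚᵘ-homo-* ⟦ i ⟧ ⟦ j ⟧ ⟨
  toℚᵘ (⟦ i ⟧ * ⟦ j ⟧)                   ∎)
  where open ℚᵘₚ.≃-Reasoning

⟦⟧-neg : ∀ i → ⟦ ℤ.- i ⟧ ≡ - ⟦ i ⟧
⟦⟧-neg i = toℚᵘ-injective (begin
  toℚᵘ ⟦ ℤ.- i ⟧           ≈⟨ toℚᵘ-⟦⟧ (ℤ.- i) ⟩
  ℚᵘ.- ℚᵘ.mkℚᵘ i 0         ≈⟨ ℚᵘₚ.-‿cong (toℚᵘ-⟦⟧ i) ⟨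
  ℚᵘ.- toℚᵘ ⟦ i ⟧          ≈⟨ toℚᵘ-homo‿- ⟦ i ⟧ ⟨
  toℚᵘ (- ⟦ i ⟧)           ∎)
  where open ℚᵘₚ.≃-Reasoning

⟦⟧-^ : ∀ i n → ⟦ i ℤ.^ n ⟧ ≡ ⟦ i ⟧ ^ℚ n
⟦⟧-^ i zero    = refl
⟦⟧-^ i (suc n) = trans (⟦⟧-* i (i ℤ.^ n)) (cong (⟦ i ⟧ *_) (⟦⟧-^ i n))

⟦⟧-≢0 : ∀ {i} → i ≢ 0ℤ → ⟦ i ⟧ ≢ 0ℚ
⟦⟧-≢0 {i} i≢0 ⟦i⟧≡0 =
  i≢0 (trans (sym (↥-/ i 1)) (trans (cong (ℤ._* gcd i (+ 1)) (p≡0⇒↥p≡0 ⟦ i ⟧ ⟦i⟧≡0)) (ℤₚ.*-zeroˡ (gcd i (+ 1)))))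

⊘-≢0 : ∀ p {q} (q≢0 : q ≢ 0ℚ) → p ⊘ q ≡ p * (1/ q) {{≢-nonZero q≢0}}
⊘-≢0 p {q} q≢0 with q ≟ 0ℚ
... | yes q≡0 = ⊥-elim (q≢0 q≡0)
... | no _    = refl

^ℚ-double : ∀ p s → p ^ℚ (2 ℕ.* s) ≡ (p * p) ^ℚ s
^ℚ-double p zero    = refl
^ℚ-double p (suc s) = begin
  p ^ℚ (2 ℕ.* suc s)         ≡⟨ cong (p ^ℚ_) (ℕₚ.*-suc 2 s) ⟩
  p * (p * p ^ℚ (2 ℕ.* s))   ≡⟨ *-assoc p p _ ⟨
  (p * p) * p ^ℚ (2 ℕ.* s)   ≡⟨ cong ((p * p) *_) (^ℚ-double p s) ⟩
  (p * p) ^ℚ suc s           ∎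
  where open ≡-Reasoning

^ℚ-odd : ∀ p r → p ^ℚ (2 ℕ.* r ℕ.+ 1) ≡ p * (p * p) ^ℚ r
^ℚ-odd p r = trans (cong (p ^ℚ_) (ℕₚ.+-comm (2 ℕ.* r) 1)) (cong (p *_) (^ℚ-double p r))

sumTo-cong : ∀ n {f g : ℕ → ℚ} → (∀ {i} → i < n → f i ≡ g i) → sumTo n f ≡ sumTo n g
sumTo-cong zero    f≗g = refl
sumTo-cong (suc n) f≗g = cong₂ _+_ (sumTo-cong n (λ i<n → f≗g (ℕₚ.m<n⇒m<1+n i<n))) (f≗g (ℕₚ.n<1+n n))

sumTo-+ : ∀ n f g → sumTo n (λ i → f i + g i) ≡ sumTo n f + sumTo n g
sumTo-+ zero    f g = refl
sumTo-+ (suc n) f g =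
  trans (cong (_+ (f n + g n)) (sumTo-+ n f g)) (interchange (sumTo n f) (sumTo n g) (f n) (g n))
  where
  interchange : ∀ a b c d → (a + b) + (c + d) ≡ (a + c) + (b + d)
  interchange = solve-∀ ℚring

sumTo-*ˡ : ∀ n c f → sumTo n (λ i → c * f i) ≡ c * sumTo n f
sumTo-*ˡ zero    c f = sym (*-zeroʳ c)
sumTo-*ˡ (suc n) c f = trans (cong (_+ c * f n) (sumTo-*ˡ n c f)) (sym (*-distribˡ-+ c _ _))

_[_]≔_ : (ℕ → ℤ) → ℕ → ℤ → ℕ → ℤ
(v [ n ]≔ a) i with i ℕ.≟ n
... | yes _ = a
... | no _  = v i

[]≔-updated : ∀ v n a → (v [ n ]≔ a) n ≡ a
[]≔-updated v n a with n ℕ.≟ n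
... | yes _   = refl
... | no n≢n  = ⊥-elim (n≢n refl)

[]≔-below : ∀ v n a {i} → i < n → (v [ n ]≔ a) i ≡ v i
[]≔-below v n a {i} i<n with i ℕ.≟ n
... | yes i≡n = ⊥-elim (ℕₚ.<⇒≢ i<n i≡n)
... | no _    = refl

sumTo-[]≔ : ∀ n (F : ℤ → ℕ → ℚ) v a →
  sumTo n (λ i → F (v i) i) + F a n ≡ sumTo (suc n) (λ i → F ((v [ n ]≔ a) i) i)
sumTo-[]≔ n F v a = cong₂ _+_
  (sumTo-cong n (λ {i} i<n → cong (λ x → F x i) (sym ([]≔-below v n a i<n))))
  (cong (λ x → F x n) (sym ([]≔-updated v n a)))

eval : ℕ → (ℕ → ℤ) → ℚ → ℚ
eval n c T = sumTo n (λ i → ⟦ c i ⟧ * T ^ℚ i)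

record IntPoly< (n : ℕ) (g : ℚ → ℚ) : Set where
  constructor poly
  field
    coefficients : ℕ → ℤ
    is-eval      : ∀ T → g T ≡ eval n coefficients T

IntPoly<-+ : ∀ {n g h} → IntPoly< n g → IntPoly< n h → IntPoly< n (λ T → g T + h T)
IntPoly<-+ {n} {g} {h} (poly c g≡) (poly d h≡) = poly (λ i → c i ℤ.+ d i) λ T → begin
  g T + h T                                            ≡⟨ cong₂ _+_ (g≡ T) (h≡ T) ⟩
  eval n c T + eval n d T                              ≡⟨ sumTo-+ n _ _ ⟨
  sumTo n (λ i → ⟦ c i ⟧ * T ^ℚ i + ⟦ d i ⟧ * T ^ℚ i)  ≡⟨ sumTo-cong n (λ {i} _ → coefficient-+ i T) ⟩
  eval n (λ i → c i ℤ.+ d i) T                         ∎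
  where
  open ≡-Reasoning
  coefficient-+ : ∀ i T → ⟦ c i ⟧ * T ^ℚ i + ⟦ d i ⟧ * T ^ℚ i ≡ ⟦ c i ℤ.+ d i ⟧ * T ^ℚ i
  coefficient-+ i T = trans (sym (*-distribʳ-+ (T ^ℚ i) ⟦ c i ⟧ ⟦ d i ⟧)) (cong (_* T ^ℚ i) (sym (⟦⟧-+ (c i) (d i))))

IntPoly<-*ˡ : ∀ {n g} a → IntPoly< n g → IntPoly< n (λ T → ⟦ a ⟧ * g T)
IntPoly<-*ˡ {n} {g} a (poly c g≡) = poly (λ i → a ℤ.* c i) λ T → begin
  ⟦ a ⟧ * g T                                ≡⟨ cong (⟦ a ⟧ *_) (g≡ T) ⟩
  ⟦ a ⟧ * eval n c T                         ≡⟨ sumTo-*ˡ n ⟦ a ⟧ _ ⟨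
  sumTo n (λ i → ⟦ a ⟧ * (⟦ c i ⟧ * T ^ℚ i))  ≡⟨ sumTo-cong n (λ {i} _ → coefficient-* i T) ⟩
  eval n (λ i → a ℤ.* c i) T                 ∎
  where
  open ≡-Reasoning
  coefficient-* : ∀ i T → ⟦ a ⟧ * (⟦ c i ⟧ * T ^ℚ i) ≡ ⟦ a ℤ.* c i ⟧ * T ^ℚ i
  coefficient-* i T = trans (sym (*-assoc ⟦ a ⟧ ⟦ c i ⟧ (T ^ℚ i))) (cong (_* T ^ℚ i) (sym (⟦⟧-* a (c i))))

shiftCoefficients : (ℕ → ℤ) → ℕ → ℤ
shiftCoefficients c zero    = 0ℤ
shiftCoefficients c (suc i) = c i

eval-shiftCoefficients : ∀ n c T → T * eval n c T ≡ eval (suc n) (shiftCoefficients c) T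
eval-shiftCoefficients zero    c T = times-zero T
  where
  times-zero : ∀ T → T * 0ℚ ≡ 0ℚ + ⟦ 0ℤ ⟧ * 1ℚ
  times-zero = solve-∀ ℚring
eval-shiftCoefficients (suc n) c T =
  trans (distribute T (eval n c T) ⟦ c n ⟧ (T ^ℚ n))
        (cong (_+ ⟦ c n ⟧ * (T * T ^ℚ n)) (eval-shiftCoefficients n c T))
  where
  distribute : ∀ T E C P → T * (E + C * P) ≡ T * E + C * (T * P)
  distribute = solve-∀ ℚring

IntPoly<-X* : ∀ {n g} → IntPoly< n g → IntPoly< (suc n) (λ T → T * g T)
IntPoly<-X* {n} (poly c g≡) = poly (shiftCoefficients c) λ T → trans (cong (T *_) (g≡ T)) (eval-shiftCoefficients n c T)

IntPoly<-+monomial : ∀ {n g} → IntPoly< n g → ∀ a → IntPoly< (suc n) (λ T → g T + ⟦ a ⟧ * T ^ℚ n)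
IntPoly<-+monomial {n} (poly c g≡) a =
  poly (c [ n ]≔ a) λ T → trans (cong (_+ _) (g≡ T)) (sumTo-[]≔ n (λ x i → ⟦ x ⟧ * T ^ℚ i) c a)

eval-geometric : ∀ r T → (T - 1ℚ) * eval r (λ _ → + 1) T ≡ T ^ℚ r - 1ℚ
eval-geometric zero    T = empty T
  where
  empty : ∀ T → (T - 1ℚ) * 0ℚ ≡ 1ℚ - 1ℚ
  empty = solve-∀ ℚring
eval-geometric (suc r) T = begin
  (T - 1ℚ) * (E + ⟦ + 1 ⟧ * T ^ℚ r)         ≡⟨ expand T E (T ^ℚ r) ⟩
  (T - 1ℚ) * E + (T * T ^ℚ r - T ^ℚ r)     ≡⟨ cong (_+ (T * T ^ℚ r - T ^ℚ r)) (eval-geometric r T) ⟩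
  (T ^ℚ r - 1ℚ) + (T * T ^ℚ r - T ^ℚ r)    ≡⟨ telescope T (T ^ℚ r) ⟩
  T * T ^ℚ r - 1ℚ                          ∎
  where
  open ≡-Reasoning
  E = eval r (λ _ → + 1) T
  expand : ∀ T E P → (T - 1ℚ) * (E + ⟦ + 1 ⟧ * P) ≡ (T - 1ℚ) * E + (T * P - P)
  expand = solve-∀ ℚring
  telescope : ∀ T P → (P - 1ℚ) + (T * P - P) ≡ T * P - 1ℚ
  telescope = solve-∀ ℚring

triangular-span : (h : ℤ) (β : ℕ → ℚ → ℚ) → (∀ s → IntPoly< s (β s)) →
  ∀ n {g} → IntPoly< n g → Σ (ℕ → ℤ) λ v → ∀ T →
    ⟦ h ⟧ ^ℚ n * g T ≡ sumTo n (λ s → ⟦ v s ⟧ * (⟦ h ⟧ * T ^ℚ s + β s T))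
triangular-span h β β-poly zero {g} (poly _ g≡) = (λ _ → 0ℤ) , λ T →
  trans (*-identityˡ (g T)) (g≡ T)
triangular-span h β β-poly (suc n) {g} (poly c g≡)
  with triangular-span h β β-poly n
         (IntPoly<-+ (IntPoly<-*ˡ h (poly c λ _ → refl)) (IntPoly<-*ˡ (ℤ.- c n) (β-poly n)))
... | v , span = (v [ n ]≔ (h ℤ.^ n ℤ.* c n)) , λ T → begin
  ⟦ h ⟧ * ⟦ h ⟧ ^ℚ n * g T
    ≡⟨ cong (⟦ h ⟧ * ⟦ h ⟧ ^ℚ n *_) (g≡ T) ⟩
  ⟦ h ⟧ * ⟦ h ⟧ ^ℚ n * (eval n c T + ⟦ c n ⟧ * T ^ℚ n)
    ≡⟨ peel ⟦ h ⟧ (⟦ h ⟧ ^ℚ n) (eval n c T) ⟦ c n ⟧ (T ^ℚ n) (β n T) ⟩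
  ⟦ h ⟧ ^ℚ n * (⟦ h ⟧ * eval n c T + (- ⟦ c n ⟧) * β n T) + (⟦ h ⟧ ^ℚ n * ⟦ c n ⟧) * b n T
    ≡⟨ cong₂ (λ x y → ⟦ h ⟧ ^ℚ n * (⟦ h ⟧ * eval n c T + x * β n T) + y * b n T)
             (sym (⟦⟧-neg (c n))) (sym (trans (⟦⟧-* (h ℤ.^ n) (c n)) (cong (_* ⟦ c n ⟧) (⟦⟧-^ h n)))) ⟩
  ⟦ h ⟧ ^ℚ n * (⟦ h ⟧ * eval n c T + ⟦ ℤ.- c n ⟧ * β n T) + ⟦ h ℤ.^ n ℤ.* c n ⟧ * b n T
    ≡⟨ cong (_+ ⟦ h ℤ.^ n ℤ.* c n ⟧ * b n T) (span T) ⟩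
  sumTo n (λ s → ⟦ v s ⟧ * b s T) + ⟦ h ℤ.^ n ℤ.* c n ⟧ * b n T
    ≡⟨ sumTo-[]≔ n (λ x s → ⟦ x ⟧ * b s T) v (h ℤ.^ n ℤ.* c n) ⟩
  sumTo (suc n) (λ s → ⟦ (v [ n ]≔ (h ℤ.^ n ℤ.* c n)) s ⟧ * b s T) ∎
  where
  open ≡-Reasoning
  b : ℕ → ℚ → ℚ
  b s T = ⟦ h ⟧ * T ^ℚ s + β s T
  -- h cₙ Tⁿ = cₙ bₙ − cₙ βₙ, and βₙ has degree < n
  peel : ∀ H Hⁿ E C P B → H * Hⁿ * (E + C * P) ≡ Hⁿ * (H * E + (- C) * B) + (Hⁿ * C) * (H * P + B)
  peel = solve-∀ ℚring

[t+2]²^s-split : ∀ s → Σ (ℚ → ℚ) λ μ → Σ (ℚ → ℚ) λ ν → IntPoly< s μ × IntPoly< s ν ×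
  (∀ t → ((t + two) * (t + two)) ^ℚ s ≡ (t * t) ^ℚ s + ⟦ + 4 ⟧ * (μ (t * t) + t * ν (t * t)))
[t+2]²^s-split zero = (λ _ → 0ℚ) , (λ _ → 0ℚ) , poly (λ _ → 0ℤ) (λ _ → refl) , poly (λ _ → 0ℤ) (λ _ → refl) , base
  where
  base : ∀ t → 1ℚ ≡ 1ℚ + ⟦ + 4 ⟧ * (0ℚ + t * 0ℚ)
  base = solve-∀ ℚring
[t+2]²^s-split (suc s) with [t+2]²^s-split s
... | μ , ν , μ-poly , ν-poly , split = μ′ , ν′ , μ′-poly , ν′-poly , λ t →
  trans (cong ((t + two) * (t + two) *_) (split t)) (step t ((t * t) ^ℚ s) (μ (t * t)) (ν (t * t)))
  where
  μ′ ν′ : ℚ → ℚ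
  μ′ T = T * (μ T + ⟦ + 4 ⟧ * ν T) + (⟦ + 4 ⟧ * μ T + ⟦ + 1 ⟧ * T ^ℚ s)
  ν′ T = T * ν T + (⟦ + 4 ⟧ * (μ T + ν T) + ⟦ + 1 ⟧ * T ^ℚ s)
  μ′-poly : IntPoly< (suc s) μ′
  μ′-poly = IntPoly<-+ (IntPoly<-X* (IntPoly<-+ μ-poly (IntPoly<-*ˡ (+ 4) ν-poly)))
                       (IntPoly<-+monomial (IntPoly<-*ˡ (+ 4) μ-poly) (+ 1))
  ν′-poly : IntPoly< (suc s) ν′
  ν′-poly = IntPoly<-+ (IntPoly<-X* ν-poly)
                       (IntPoly<-+monomial (IntPoly<-*ˡ (+ 4) (IntPoly<-+ μ-poly ν-poly)) (+ 1))
  step : ∀ t P M N → (t + two) * (t + two) * (P + ⟦ + 4 ⟧ * (M + t * N))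
       ≡ (t * t) * P + ⟦ + 4 ⟧ * (((t * t) * (M + ⟦ + 4 ⟧ * N) + (⟦ + 4 ⟧ * M + ⟦ + 1 ⟧ * P))
                                 + t * ((t * t) * N + (⟦ + 4 ⟧ * (M + N) + ⟦ + 1 ⟧ * P)))
  step = solve-∀ ℚring

half quarter : ℚ
half    = + 1 / 2
quarter = + 1 / 4

xFrom : (ℚ → ℚ) → ℚ → ℚ
xFrom p k = two * p (two * k + three) * (k + 1ℚ) * (k + two)

Ladj-cong : ∀ ε z {x y : ℚ → ℚ} → (∀ k → x k ≡ y k) → ∀ k → Ladj ε z x k ≡ Ladj ε z y k
Ladj-cong ε z x≗y k = cong₂ _+_
  (cong₂ _+_ (cong (a₀ ε z k *_) (x≗y k)) (cong (a₁ ε z (k - 1ℚ) *_) (x≗y (k - 1ℚ))))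
  (cong (a₂ ε z (k - two) *_) (x≗y (k - two)))

Ladj-xFrom : ∀ ε z p k → let t = two * k + 1ℚ in
  Ladj ε z (xFrom p) k
    ≡ (t * t - 1ℚ) * ((t + three) * p (t + two) + (t - three) * p (t - two)
                      - two * ⟦ ε ⟧ * (1ℚ + two * ⟦ z ⟧) * t * p t) * quarter
Ladj-xFrom ε z p k = begin
  Ladj ε z (xFrom p) k
    ≡⟨ expand k ⟦ ε ⟧ ⟦ z ⟧ X₀ Y₀ Z₀ ⟩
  closed X₀ Y₀ Z₀
    ≡⟨ cong (λ X → closed X Y₀ Z₀) (cong p (shift₀ k)) ⟩
  closed (p (t + two)) Y₀ Z₀
    ≡⟨ cong₂ (closed (p (t + two))) (cong p (shift₁ k)) (cong p (shift₂ k)) ⟩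
  closed (p (t + two)) (p t) (p (t - two)) ∎
  where
  open ≡-Reasoning
  t X₀ Y₀ Z₀ : ℚ
  t  = two * k + 1ℚ
  X₀ = p (two * k + three)
  Y₀ = p (two * (k - 1ℚ) + three)
  Z₀ = p (two * (k - two) + three)
  closed : ℚ → ℚ → ℚ → ℚ
  closed X Y Z = (t * t - 1ℚ) * ((t + three) * X + (t - three) * Z - two * ⟦ ε ⟧ * (1ℚ + two * ⟦ z ⟧) * t * Y) * quarter
  expand : ∀ k E W X Y Z →
      k * (two * X * (k + 1ℚ) * (k + two))
    + (- (E * ((two * (k - 1ℚ) + three) * (1ℚ + two * W)))) * (two * Y * ((k - 1ℚ) + 1ℚ) * ((k - 1ℚ) + two))
    + ((k - two) + three) * (two * Z * ((k - two) + 1ℚ) * ((k - two) + two))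
    ≡ ((two * k + 1ℚ) * (two * k + 1ℚ) - 1ℚ)
      * (((two * k + 1ℚ) + three) * X + ((two * k + 1ℚ) - three) * Z
         - two * E * (1ℚ + two * W) * (two * k + 1ℚ) * Y) * quarter
  expand = solve-∀ ℚring
  shift₀ : ∀ k → two * k + three ≡ (two * k + 1ℚ) + two
  shift₀ = solve-∀ ℚring
  shift₁ : ∀ k → two * (k - 1ℚ) + three ≡ two * k + 1ℚ
  shift₁ = solve-∀ ℚring
  shift₂ : ∀ k → two * (k - two) + three ≡ (two * k + 1ℚ) - two
  shift₂ = solve-∀ ℚring

Ladj-x[2s+2] : ∀ ε z s → Σ (ℚ → ℚ) λ β → IntPoly< s β × ∀ k → let t = two * k + 1ℚ in
  Ladj ε z x[ 2 ℕ.* s +2] k ≡ (t * t - 1ℚ) * t * (η ε z * (t * t) ^ℚ s + β (t * t))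
Ladj-x[2s+2] ε z s with [t+2]²^s-split s
... | μ , ν , μ-poly , ν-poly , split =
  β , IntPoly<-+ (IntPoly<-*ˡ (+ 2) μ-poly) (IntPoly<-*ˡ (+ 6) ν-poly) , Ladj≡
  where
  p β : ℚ → ℚ
  p u = (u * u) ^ℚ s
  β T = ⟦ + 2 ⟧ * μ T + ⟦ + 6 ⟧ * ν T

  split-neg : ∀ t → p (t - two) ≡ (t * t) ^ℚ s + ⟦ + 4 ⟧ * (μ (t * t) + (- t) * ν (t * t))
  split-neg t = begin
    p (t - two)       ≡⟨ cong (_^ℚ s) (flip t) ⟩
    p (- t + two)     ≡⟨ split (- t) ⟩
    ((- t) * (- t)) ^ℚ s + ⟦ + 4 ⟧ * (μ ((- t) * (- t)) + (- t) * ν ((- t) * (- t)))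
      ≡⟨ cong (λ T → T ^ℚ s + ⟦ + 4 ⟧ * (μ T + (- t) * ν T)) (neg-square t) ⟩
    (t * t) ^ℚ s + ⟦ + 4 ⟧ * (μ (t * t) + (- t) * ν (t * t)) ∎
    where
    open ≡-Reasoning
    flip : ∀ t → (t - two) * (t - two) ≡ (- t + two) * (- t + two)
    flip = solve-∀ ℚring
    neg-square : ∀ t → (- t) * (- t) ≡ t * t
    neg-square = solve-∀ ℚring

  Ladj≡ : ∀ k → let t = two * k + 1ℚ in
    Ladj ε z x[ 2 ℕ.* s +2] k ≡ (t * t - 1ℚ) * t * (η ε z * (t * t) ^ℚ s + β (t * t))
  Ladj≡ k = begin
    Ladj ε z x[ 2 ℕ.* s +2] k
      ≡⟨ Ladj-cong ε z (λ k → cong (λ X → two * X * (k + 1ℚ) * (k + two)) (^ℚ-double (two * k + three) s)) k ⟩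
    Ladj ε z (xFrom p) k
      ≡⟨ Ladj-xFrom ε z p k ⟩
    (T - 1ℚ) * ((t + three) * p (t + two) + (t - three) * p (t - two) - two * E * (1ℚ + two * W) * t * P) * quarter
      ≡⟨ cong₂ (λ X Z → (T - 1ℚ) * ((t + three) * X + (t - three) * Z - two * E * (1ℚ + two * W) * t * P) * quarter)
               (split t) (split-neg t) ⟩
    (T - 1ℚ) * ((t + three) * (P + ⟦ + 4 ⟧ * (μ T + t * ν T)) + (t - three) * (P + ⟦ + 4 ⟧ * (μ T + (- t) * ν T))
                - two * E * (1ℚ + two * W) * t * P) * quarter
      ≡⟨ collect t E W P (μ T) (ν T) ⟩
    -- η ε z computes to (1 - ε (1 + 2z)) * half, so this is the claimed right-hand side
    (T - 1ℚ) * t * ((1ℚ - E * (1ℚ + two * W)) * half * P + β T) ∎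
    where
    open ≡-Reasoning
    t T P E W : ℚ
    t = two * k + 1ℚ
    T = t * t
    P = T ^ℚ s
    E = ⟦ ε ⟧
    W = ⟦ z ⟧
    collect : ∀ t E W P M N →
        (t * t - 1ℚ) * ((t + three) * (P + ⟦ + 4 ⟧ * (M + t * N)) + (t - three) * (P + ⟦ + 4 ⟧ * (M + (- t) * N))
                       - two * E * (1ℚ + two * W) * t * P) * quarter
      ≡ (t * t - 1ℚ) * t * ((1ℚ - E * (1ℚ + two * W)) * half * P + (⟦ + 2 ⟧ * M + ⟦ + 6 ⟧ * N))
    collect = solve-∀ ℚring

η-integral : ∀ ε z → (ε ≡ + 1 ⊎ ε ≡ -[1+ 0 ]) → z ℤ.* (z ℤ.+ + 1) ≢ 0ℤ →
  Σ ℤ λ h → η ε z ≡ ⟦ h ⟧ × h ≢ 0ℤ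
η-integral ε z (inj₁ refl) z[z+1]≢0 = ℤ.- z , trans (η₊ ⟦ z ⟧) (sym (⟦⟧-neg z)) , -z≢0
  where
  η₊ : ∀ W → (1ℚ - ⟦ + 1 ⟧ * (1ℚ + two * W)) * half ≡ - W
  η₊ = solve-∀ ℚring
  -z≢0 : ℤ.- z ≢ 0ℤ
  -z≢0 -z≡0 = z[z+1]≢0 (begin
    z ℤ.* (z ℤ.+ + 1)   ≡⟨ cong (ℤ._* (z ℤ.+ + 1)) (trans (sym (ℤₚ.neg-involutive z)) (cong ℤ.-_ -z≡0)) ⟩
    0ℤ ℤ.* (z ℤ.+ + 1)  ≡⟨ ℤₚ.*-zeroˡ (z ℤ.+ + 1) ⟩
    0ℤ                  ∎)
    where open ≡-Reasoning
η-integral ε z (inj₂ refl) z[z+1]≢0 = z ℤ.+ + 1 , trans (η₋ ⟦ z ⟧) (sym (⟦⟧-+ z (+ 1))) , z+1≢0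
  where
  η₋ : ∀ W → (1ℚ - ⟦ -[1+ 0 ] ⟧ * (1ℚ + two * W)) * half ≡ W + ⟦ + 1 ⟧
  η₋ = solve-∀ ℚring
  z+1≢0 : z ℤ.+ + 1 ≢ 0ℤ
  z+1≢0 z+1≡0 = z[z+1]≢0 (trans (cong (z ℤ.*_) z+1≡0) (ℤₚ.*-zeroʳ z))

odd-power-combination : (h : ℤ) → h ≢ 0ℤ → (β : ℕ → ℚ → ℚ) → (∀ s → IntPoly< s (β s)) →
  (B : ℕ → ℚ → ℚ) →
  (∀ s k → let t = two * k + 1ℚ in B s k ≡ (t * t - 1ℚ) * t * (⟦ h ⟧ * (t * t) ^ℚ s + β s (t * t))) →
  ∀ r → Σ (ℕ → ℤ) λ v → ∀ k → let t = two * k + 1ℚ in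
    t ^ℚ (2 ℕ.* r ℕ.+ 1) ≡ sumTo r (λ s → (⟦ v s ⟧ ⊘ (⟦ h ⟧ ^ℚ r)) * B s k) + t
odd-power-combination h h≢0 β β-poly B B≡ r
  with triangular-span h β β-poly r (poly (λ _ → + 1) λ _ → refl)
... | v , span = v , λ k → sym (combination k)
  where
  H : ℚ
  H = ⟦ h ⟧ ^ℚ r
  H≢0 : H ≢ 0ℚ
  H≢0 H≡0 = ⟦⟧-≢0 (λ hʳ≡0 → h≢0 (ℤₚ.i^n≡0⇒i≡0 h r hʳ≡0)) (trans (⟦⟧-^ h r) H≡0)
  instance
    H-nonZero : NonZero H
    H-nonZero = ≢-nonZero H≢0

  combination : ∀ k → let t = two * k + 1ℚ in
    sumTo r (λ s → (⟦ v s ⟧ ⊘ H) * B s k) + t ≡ t ^ℚ (2 ℕ.* r ℕ.+ 1)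
  combination k = begin
    sumTo r (λ s → (⟦ v s ⟧ ⊘ H) * B s k) + t
      ≡⟨ cong (_+ t) (sumTo-cong r (λ {s} _ → summand s)) ⟩
    sumTo r (λ s → C * (⟦ v s ⟧ * b s)) + t   ≡⟨ cong (_+ t) (sumTo-*ˡ r C _) ⟩
    C * sumTo r (λ s → ⟦ v s ⟧ * b s) + t     ≡⟨ cong (λ S → C * S + t) (span T) ⟨
    C * (H * G) + t                           ≡⟨ cong (_+ t) (cancel (1/ H) H D G) ⟩
    ((1/ H) * H) * (D * G) + t               ≡⟨ cong (λ I → I * (D * G) + t) (*-inverseˡ H) ⟩
    1ℚ * (D * G) + t                          ≡⟨ regroup t T G ⟩
    t * ((T - 1ℚ) * G) + t                    ≡⟨ cong (λ X → t * X + t) (eval-geometric r T) ⟩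
    t * (T ^ℚ r - 1ℚ) + t                     ≡⟨ telescope t (T ^ℚ r) ⟩
    t * T ^ℚ r                                ≡⟨ ^ℚ-odd t r ⟨
    t ^ℚ (2 ℕ.* r ℕ.+ 1)                      ∎
    where
    open ≡-Reasoning
    t T D G C : ℚ
    t = two * k + 1ℚ
    T = t * t
    D = (T - 1ℚ) * t
    G = eval r (λ _ → + 1) T
    C = 1/ H * D
    b : ℕ → ℚ
    b s = ⟦ h ⟧ * T ^ℚ s + β s T
    summand : ∀ s → (⟦ v s ⟧ ⊘ H) * B s k ≡ C * (⟦ v s ⟧ * b s)
    summand s = trans (cong₂ _*_ (⊘-≢0 ⟦ v s ⟧ H≢0) (B≡ s k)) (swap ⟦ v s ⟧ (1/ H) D (b s))
      where
      swap : ∀ V I D b → (V * I) * (D * b) ≡ (I * D) * (V * b)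
      swap = solve-∀ ℚring
    cancel : ∀ I H D G → (I * D) * (H * G) ≡ (I * H) * (D * G)
    cancel = solve-∀ ℚring
    regroup : ∀ t T G → 1ℚ * (((T - 1ℚ) * t) * G) + t ≡ t * ((T - 1ℚ) * G) + t
    regroup = solve-∀ ℚring
    telescope : ∀ t P → t * (P - 1ℚ) + t ≡ t * P
    telescope = solve-∀ ℚring

lemma3p1 : (ε z : ℤ) → (ε ≡ + 1 ⊎ ε ≡ -[1+ 0 ]) → Data.Integer._*_ z (Data.Integer._+_ z (+ 1)) ≢ + 0 →
    (r : ℕ) → Σ (ℕ → ℕ) λ u → Σ (ℕ → ℤ) λ v →
      (k : ℚ) →
        ((two * k + 1ℚ) ^ℚ (Data.Nat._+_ (Data.Nat._*_ 2 r) 1))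
          ≡ sumTo r (λ s → (⟦ v s ⟧ ⊘ (η ε z ^ℚ u s)) * Ladj ε z x[ Data.Nat._*_ 2 s +2] k)
            + (two * k + 1ℚ)
lemma3p1 ε z ε≡±1 z[z+1]≢0 r with η-integral ε z ε≡±1 z[z+1]≢0
... | h , η≡h , h≢0 rewrite η≡h =
  (λ _ → r) , odd-power-combination h h≢0 β β-poly (λ s → Ladj ε z x[ 2 ℕ.* s +2]) Ladj≡ r
  where
  β : ℕ → ℚ → ℚ
  β s = proj₁ (Ladj-x[2s+2] ε z s)
  β-poly : ∀ s → IntPoly< s (β s)
  β-poly s = proj₁ (proj₂ (Ladj-x[2s+2] ε z s))
  Ladj≡ : ∀ s k → let t = two * k + 1ℚ in
    Ladj ε z x[ 2 ℕ.* s +2] k ≡ (t * t - 1ℚ) * t * (⟦ h ⟧ * (t * t) ^ℚ s + β s (t * t))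
  Ladj≡ s k = subst (λ Y → Ladj ε z x[ 2 ℕ.* s +2] k ≡ (t * t - 1ℚ) * t * (Y * (t * t) ^ℚ s + β s (t * t)))
                    η≡h (proj₂ (proj₂ (Ladj-x[2s+2] ε z s)) k)
    where t = two * k + 1ℚ
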